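{- Let $a_n$ be the number of Cayley permutations of length $n$ that avoid the pattern $231$. Then $a_0=a_1=1$ and, for $n\ge 1$, \[ a_{n+1}=\sum_{i=0}^{n-1}(4a_i-1)\,a_{n-i}. \]
   Context: A Cayley permutation of length $n$ is a word $w=w_1\cdots w_n$ of positive integers with $\{w_1,\dots,w_n\}=[k]$ for some $k\le n$ (the empty word has length $0$). It contains $231$ if there are $i<j<k$ with $w_k<w_i<w_j$, and otherwise avoids $231$. -}

module Defs where

open import Data.Nat using (ℕ; zero; suc; _<_; _≤_; _<?_; _≤?_; _≟_)
open import Data.Fin using (Fin; toℕ)
open import Data.Fin.Properties using (any?; all?)
open import Data.Vec using (Vec; []; _∷_; lookup)
open import Data.List using (List; []; _∷_; length; filter; map; concatMap; upTo)
open import Data.Product using (Σ; ∃; _×_; _,_)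
open import Relation.Binary.PropositionalEquality using (_≡_)
open import Relation.Nullary using (¬_; Dec)
open import Relation.Nullary.Decidable using (_×-dec_; ¬?)

IsCayley : ∀ {n} → Vec ℕ n → Set
IsCayley {n} w =
  Σ (Fin (suc n)) λ k →
    ((i : Fin n) → (1 ≤ lookup w i) × (lookup w i ≤ toℕ k))
    × ((j : Fin (toℕ k)) → Σ (Fin n) λ i → lookup w i ≡ suc (toℕ j))

Contains231 : ∀ {n} → Vec ℕ n → Set
Contains231 {n} w =
  Σ (Fin n) λ i → Σ (Fin n) λ j → Σ (Fin n) λ k →
    (toℕ i < toℕ j) × (toℕ j < toℕ k)
    × (lookup w k < lookup w i) × (lookup w i < lookup w j)

Avoids231 : ∀ {n} → Vec ℕ n → Set
Avoids231 w = ¬ Contains231 w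

-- Decision procedures (carrying proofs, so the count below is correct by construction).
isCayley? : ∀ {n} (w : Vec ℕ n) → Dec (IsCayley w)
isCayley? {n} w =
  any? λ k → all? (λ i → (1 ≤? lookup w i) ×-dec (lookup w i ≤? toℕ k))
             ×-dec all? λ j → any? λ i → lookup w i ≟ suc (toℕ j)

contains231? : ∀ {n} (w : Vec ℕ n) → Dec (Contains231 w)
contains231? w =
  any? λ i → any? λ j → any? λ k →
    (toℕ i <? toℕ j) ×-dec (toℕ j <? toℕ k)
    ×-dec (lookup w k <? lookup w i) ×-dec (lookup w i <? lookup w j)

-- All words of length n with letters in {0,...,m-1} (each exactly once in the list).
words : (n m : ℕ) → List (Vec ℕ n)
words zero    m = [] ∷ []
words (suc n) m = concatMap (λ x → map (x ∷_) (words n m)) (upTo m)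

-- Every Cayley permutation of length n has letters in {1,...,n} ⊆ {0,...,n},
-- so it suffices to filter the words with letters < suc n.
cayley231? : ∀ {n} (w : Vec ℕ n) → Dec (IsCayley w × Avoids231 w)
cayley231? w = isCayley? w ×-dec ¬? (contains231? w)

a : ℕ → ℕ
a n = length (filter cayley231? (words n (suc n)))

-- Cut a 231-avoiding Cayley permutation w ≠ ε at the first occurrence of its maximum M: w = α M δ.
-- A letter of α above a letter of δ would form a 231 with M, so α ≤ δ letterwise. Hence α is a
-- 231-avoiding Cayley permutation, with maximum s say, and δ is a 231-avoiding Cayley permutation β
-- with maximum k shifted up by o, where o = s, or o = s - 1 when s reappears in δ; and M - o is k + 1,
-- or k when M reappears in δ. Conversely every such choice glues to a 231-avoiding Cayley permutation,
-- uniquely. If α ≠ ε there are 1, 3 or 4 choices of (o, M - o) according as k = 0, k = 1 or k ≥ 2, and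
-- only β = 1⋯1 has k = 1, so a right part of length i ≥ 1 contributes 4aᵢ - 1 and one of length 0
-- contributes 1; if α = ε there are 2 choices, which with the term i = 0 make up the 3aₙ.

module Submission where

open import Defs
open import Data.Bool using (true; false; if_then_else_)
open import Data.Empty using (⊥)
open import Data.Fin using (Fin; toℕ; fromℕ<) renaming (zero to fzero; suc to fsuc)
open import Data.Fin.Properties using (toℕ-fromℕ<; toℕ<n)
import Data.Integer as ℤ
import Data.Integer.Properties as ℤ
open import Data.List using (List; []; _∷_; _++_; [_]; map; concatMap; foldr; length; filter; replicate; upTo; applyUpTo)
open import Data.List.Extrema.Nat using (max; max<v⁺; xs≤max; max≤v⁺; max≈v⁺; argmax-sel)
open import Data.List.Membership.Propositional using (_∈_; _∉_; find)
open import Data.List.Membership.Propositional.Properties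
open import Data.List.Properties
  using (length-++; length-map; length-replicate; length-applyUpTo; length-removeAt′; ∷-injective;
         map-∘; map-++; map-cong; map-cong-local; map-id-local; map-injective; upTo-∷ʳ)
open import Data.List.Relation.Binary.Subset.Propositional using (_⊆_)
open import Data.List.Relation.Unary.All as All using (All; []; _∷_)
import Data.List.Relation.Unary.All.Properties as All
open import Data.List.Relation.Unary.AllPairs using ([]; _∷_)
open import Data.List.Relation.Unary.Any as Any using (Any; here; there; _─_)
import Data.List.Relation.Unary.Any.Properties as Any
open import Data.List.Relation.Unary.Unique.Propositional using (Unique)
import Data.List.Relation.Unary.Unique.Propositional.Properties as Unique
open import Data.Nat
open import Data.List.Membership.DecPropositional _≟_ using (_∈?_)
open import Data.Nat.ListAction using (sum)
open import Data.Nat.ListAction.Properties using (sum-++)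
open import Data.Nat.Properties
open import Algebra.Properties.CommutativeSemigroup +-commutativeSemigroup using (interchange)
open import Data.Nat.Tactic.RingSolver using (solve-∀)
open import Data.Product using (∃; ∃₂; Σ; _×_; _,_; proj₁; proj₂)
open import Data.Sum using (_⊎_; inj₁; inj₂)
open import Data.Vec using (Vec; []; _∷_; head; lookup; toList; fromList)
import Data.Vec.Membership.Propositional.Properties as Vec∈
open import Data.Vec.Properties using (toList-injective; cast-is-id; toList∘fromList; length-toList)
import Data.Vec.Relation.Unary.Any as VecAny
import Data.Vec.Relation.Unary.Any.Properties as VecAny
open import Function using (id; _∘_)
open import Relation.Binary.PropositionalEquality hiding ([_])
open import Relation.Nullary using (¬_; does; yes; no; contradiction)
open import Relation.Unary using (Decidable)

module _ {A : Set} where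

  ∈-─⁺ : ∀ {x v : A} {ys} (x∈ys : x ∈ ys) → v ∈ ys → v ≢ x → v ∈ (ys ─ x∈ys)
  ∈-─⁺ (here refl)  (here refl) v≢x = contradiction refl v≢x
  ∈-─⁺ (here refl)  (there v∈)  _   = v∈
  ∈-─⁺ (there x∈ys) (here refl) _   = here refl
  ∈-─⁺ (there x∈ys) (there v∈)  v≢x = there (∈-─⁺ x∈ys v∈ v≢x)

  Unique-⊆⇒length≤ : ∀ {xs ys : List A} → Unique xs → xs ⊆ ys → length xs ≤ length ys
  Unique-⊆⇒length≤ {[]}     _            _     = z≤n
  Unique-⊆⇒length≤ {x ∷ xs} {ys} (x∉xs ∷ uxs) xs⊆ys = begin
    suc (length xs)          ≤⟨ s≤s (Unique-⊆⇒length≤ uxs xs⊆ys─x) ⟩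
    suc (length (ys ─ x∈ys)) ≡⟨ length-removeAt′ ys _ ⟨
    length ys                ∎
    where
    open ≤-Reasoning
    x∈ys = xs⊆ys (here refl)
    xs⊆ys─x : xs ⊆ (ys ─ x∈ys)
    xs⊆ys─x v∈xs = ∈-─⁺ x∈ys (xs⊆ys (there v∈xs)) λ { refl → All.lookup x∉xs v∈xs refl }

  Unique-⊆⊇⇒length≡ : ∀ {xs ys : List A} → Unique xs → Unique ys → xs ⊆ ys → ys ⊆ xs →
                      length xs ≡ length ys
  Unique-⊆⊇⇒length≡ uxs uys xs⊆ys ys⊆xs =
    ≤-antisym (Unique-⊆⇒length≤ uxs xs⊆ys) (Unique-⊆⇒length≤ uys ys⊆xs)

module _ {A B : Set} where

  Unique-map⁺-∈ : (f : A → B) {xs : List A} → Unique xs →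
                  (∀ {x y} → x ∈ xs → y ∈ xs → f x ≡ f y → x ≡ y) → Unique (map f xs)
  Unique-map⁺-∈ f {[]}     _            _   = []
  Unique-map⁺-∈ f {x ∷ xs} (x∉xs ∷ uxs) inj =
    All.tabulate fx≢ ∷ Unique-map⁺-∈ f uxs (λ p q → inj (there p) (there q))
    where
    fx≢ : ∀ {z} → z ∈ map f xs → f x ≢ z
    fx≢ z∈ fx≡z with y , y∈xs , refl ← ∈-map⁻ f z∈ =
      All.lookup x∉xs y∈xs (inj (here refl) (there y∈xs) fx≡z)

  Unique-concatMap⁺ : (π : B → A) (f : A → List B) {xs : List A} → Unique xs →
                      (∀ {x} → x ∈ xs → Unique (f x)) → (∀ {x y} → x ∈ xs → y ∈ f x → π y ≡ x) →
                      Unique (concatMap f xs)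
  Unique-concatMap⁺ π f {[]}     _            _  _    = []
  Unique-concatMap⁺ π f {x ∷ xs} (x∉xs ∷ uxs) uf inv =
    Unique.++⁺ (uf (here refl)) (Unique-concatMap⁺ π f uxs (uf ∘ there) (inv ∘ there)) disjoint
    where
    disjoint : ∀ {y} → y ∈ f x × y ∈ concatMap f xs → ⊥
    disjoint (y∈fx , y∈rest) with x′ , x′∈xs , y∈fx′ ← find (∈-concatMap⁻ f {xs = xs} y∈rest) =
      All.lookup x∉xs x′∈xs (trans (sym (inv (here refl) y∈fx)) (inv (there x′∈xs) y∈fx′))

∈-concatMap⁻′ : ∀ {A B : Set} (f : A → List B) xs {y} → y ∈ concatMap f xs →
                ∃ λ x → x ∈ xs × y ∈ f x
∈-concatMap⁻′ f xs y∈ = find (∈-concatMap⁻ f {xs = xs} y∈)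

∈-concatMap⁺′ : ∀ {A B : Set} (f : A → List B) {xs x y} → x ∈ xs → y ∈ f x → y ∈ concatMap f xs
∈-concatMap⁺′ f {xs} x∈ y∈ = ∈-concatMap⁺ f {xs = xs} (Any.map (λ { refl → y∈ }) x∈)

length-concatMap : ∀ {A B : Set} (f : A → List B) xs → length (concatMap f xs) ≡ sum (map (length ∘ f) xs)
length-concatMap f []       = refl
length-concatMap f (x ∷ xs) = trans (length-++ (f x)) (cong (length (f x) +_) (length-concatMap f xs))

sum-map-const : ∀ {A : Set} (xs : List A) c → sum (map (λ _ → c) xs) ≡ length xs * c
sum-map-const []       c = refl
sum-map-const (x ∷ xs) c = cong (c +_) (sum-map-const xs c)

sum-map-+ : ∀ {A : Set} (f g : A → ℕ) xs → sum (map (λ x → f x + g x) xs) ≡ sum (map f xs) + sum (map g xs)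
sum-map-+ f g []       = refl
sum-map-+ f g (x ∷ xs) = trans (cong (f x + g x +_) (sum-map-+ f g xs)) (interchange (f x) (g x) _ _)

sum-map-cong-∈ : ∀ {A : Set} {f g : A → ℕ} xs → (∀ {x} → x ∈ xs → f x ≡ g x) →
                 sum (map f xs) ≡ sum (map g xs)
sum-map-cong-∈ xs f≡g = cong sum (map-cong-local (All.tabulate f≡g))

sum-indicator : ∀ {A : Set} {P : A → Set} (P? : Decidable P) xs →
                sum (map (λ x → if does (P? x) then 1 else 0) xs) ≡ length (filter P? xs)
sum-indicator P? []       = refl
sum-indicator P? (x ∷ xs) with does (P? x)
... | true  = cong suc (sum-indicator P? xs)
... | false = sum-indicator P? xs

sum-upTo-suc : ∀ (f : ℕ → ℕ) n → sum (map f (upTo (suc n))) ≡ sum (map f (upTo n)) + f n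
sum-upTo-suc f n = begin
  sum (map f (upTo (suc n)))           ≡⟨ cong (sum ∘ map f) (upTo-∷ʳ n) ⟨
  sum (map f (upTo n ++ [ n ]))        ≡⟨ cong sum (map-++ f (upTo n) [ n ]) ⟩
  sum (map f (upTo n) ++ [ f n ])      ≡⟨ sum-++ (map f (upTo n)) [ f n ] ⟩
  sum (map f (upTo n)) + (f n + 0)     ≡⟨ cong (λ k → sum (map f (upTo n)) + k) (+-identityʳ (f n)) ⟩
  sum (map f (upTo n)) + f n           ∎
  where open ≡-Reasoning

length≡0⇒[] : ∀ {A : Set} {xs : List A} → length xs ≡ 0 → xs ≡ []
length≡0⇒[] {xs = []} _ = refl

max-∈ : ∀ {xs} → 1 ≤ max 0 xs → max 0 xs ∈ xs
max-∈ {xs} 1≤m with argmax-sel id 0 xs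
... | inj₁ m≡0 = contradiction m≡0 (>⇒≢ 1≤m)
... | inj₂ m∈  = m∈

∈⇒≤max : ∀ {x xs} → x ∈ xs → x ≤ max 0 xs
∈⇒≤max {xs = xs} = All.lookup (xs≤max 0 xs)

max≤ : ∀ {v xs} → All (_≤ v) xs → max 0 xs ≤ v
max≤ = max≤v⁺ z≤n

max-≡ : ∀ {v xs} → v ∈ xs → All (_≤ v) xs → max 0 xs ≡ v
max-≡ v∈ all = max≈v⁺ v∈ all z≤n

-- 231 in lists

-- x plays the 2 of an occurrence of 231 in x ∷ ys.
Starts231 : ℕ → List ℕ → Set
Starts231 x []       = ⊥
Starts231 x (y ∷ ys) = (x < y × Any (_< x) ys) ⊎ Starts231 x ys

Contains231ˡ : List ℕ → Set
Contains231ˡ []       = ⊥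
Contains231ˡ (x ∷ xs) = Starts231 x xs ⊎ Contains231ˡ xs

Avoids231ˡ : List ℕ → Set
Avoids231ˡ w = ¬ Contains231ˡ w

IsCayleyˡ : List ℕ → Set
IsCayleyˡ w = All (1 ≤_) w × (∀ j → 1 ≤ j → j ≤ max 0 w → j ∈ w)

Starts231⇒bigger : ∀ {x ys} → Starts231 x ys → Any (x <_) ys
Starts231⇒bigger {ys = y ∷ ys} (inj₁ (x<y , _)) = here x<y
Starts231⇒bigger {ys = y ∷ ys} (inj₂ p)         = there (Starts231⇒bigger p)

Starts231⇒smaller : ∀ {x ys} → Starts231 x ys → Any (_< x) ys
Starts231⇒smaller {ys = y ∷ ys} (inj₁ (_ , z<x)) = there z<x
Starts231⇒smaller {ys = y ∷ ys} (inj₂ p)         = there (Starts231⇒smaller p)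

no-smaller : ∀ {x ys} → All (x ≤_) ys → ¬ Any (_< x) ys
no-smaller = All.lookupWith (λ x≤z z<x → <⇒≱ z<x x≤z)

no-bigger : ∀ {x ys} → All (_≤ x) ys → ¬ Any (x <_) ys
no-bigger = All.lookupWith (λ z≤x x<z → <⇒≱ x<z z≤x)

Starts231-++ˡ : ∀ {x} xs ys → Starts231 x xs → Starts231 x (xs ++ ys)
Starts231-++ˡ (y ∷ xs) ys (inj₁ (x<y , z<x)) = inj₁ (x<y , Any.++⁺ˡ z<x)
Starts231-++ˡ (y ∷ xs) ys (inj₂ p)           = inj₂ (Starts231-++ˡ xs ys p)

Starts231-++⁻ : ∀ {x} xs ys → All (x ≤_) ys → Starts231 x (xs ++ ys) → Starts231 x xs
Starts231-++⁻ [] ys x≤ys p = contradiction (Starts231⇒smaller p) (no-smaller x≤ys)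
Starts231-++⁻ (y ∷ xs) ys x≤ys (inj₁ (x<y , z<x)) with Any.++⁻ xs z<x
... | inj₁ z<x∈xs = inj₁ (x<y , z<x∈xs)
... | inj₂ z<x∈ys = contradiction z<x∈ys (no-smaller x≤ys)
Starts231-++⁻ (y ∷ xs) ys x≤ys (inj₂ p) = inj₂ (Starts231-++⁻ xs ys x≤ys p)

Contains231-++ˡ : ∀ xs ys → Contains231ˡ xs → Contains231ˡ (xs ++ ys)
Contains231-++ˡ (x ∷ xs) ys (inj₁ p) = inj₁ (Starts231-++ˡ xs ys p)
Contains231-++ˡ (x ∷ xs) ys (inj₂ c) = inj₂ (Contains231-++ˡ xs ys c)

Contains231-++ʳ : ∀ xs ys → Contains231ˡ ys → Contains231ˡ (xs ++ ys)
Contains231-++ʳ []       ys c = c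
Contains231-++ʳ (x ∷ xs) ys c = inj₂ (Contains231-++ʳ xs ys c)

Contains231-++⁻ : ∀ xs ys → All (λ x → All (x ≤_) ys) xs →
                  Contains231ˡ (xs ++ ys) → Contains231ˡ xs ⊎ Contains231ˡ ys
Contains231-++⁻ []       ys _            c        = inj₂ c
Contains231-++⁻ (x ∷ xs) ys (x≤ys ∷ _)   (inj₁ p) = inj₁ (inj₁ (Starts231-++⁻ xs ys x≤ys p))
Contains231-++⁻ (x ∷ xs) ys (_ ∷ xs≤ys) (inj₂ c) with Contains231-++⁻ xs ys xs≤ys c
... | inj₁ c′ = inj₁ (inj₂ c′)
... | inj₂ c′ = inj₂ c′

Contains231-∷-max : ∀ {m} ys → All (_≤ m) ys → Contains231ˡ (m ∷ ys) → Contains231ˡ ys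
Contains231-∷-max ys ys≤m (inj₁ p) = contradiction (Starts231⇒bigger p) (no-bigger ys≤m)
Contains231-∷-max ys ys≤m (inj₂ c) = c

Contains231-across : ∀ {x m z} xs ys → x ∈ xs → x < m → z ∈ ys → z < x →
                     Contains231ˡ (xs ++ m ∷ ys)
Contains231-across {m = m} (x ∷ xs) ys (here refl) x<m z∈ys z<x = inj₁ (starts xs)
  where
  starts : ∀ us → Starts231 x (us ++ m ∷ ys)
  starts []       = inj₁ (x<m , Any.map (λ { refl → z<x }) z∈ys)
  starts (u ∷ us) = inj₂ (starts us)
Contains231-across (_ ∷ xs) ys (there x∈xs) x<m z∈ys z<x =
  inj₂ (Contains231-across xs ys x∈xs x<m z∈ys z<x)

module _ (f : ℕ → ℕ) where

  Starts231-map⁺ : (∀ {x y} → x < y → f x < f y) → ∀ {x} ys → Starts231 x ys → Starts231 (f x) (map f ys)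
  Starts231-map⁺ mono (y ∷ ys) (inj₁ (x<y , z<x)) = inj₁ (mono x<y , Any.map⁺ (Any.map mono z<x))
  Starts231-map⁺ mono (y ∷ ys) (inj₂ p)           = inj₂ (Starts231-map⁺ mono ys p)

  Contains231-map⁺ : (∀ {x y} → x < y → f x < f y) → ∀ xs → Contains231ˡ xs → Contains231ˡ (map f xs)
  Contains231-map⁺ mono (x ∷ xs) (inj₁ p) = inj₁ (Starts231-map⁺ mono xs p)
  Contains231-map⁺ mono (x ∷ xs) (inj₂ c) = inj₂ (Contains231-map⁺ mono xs c)

  Starts231-map⁻ : (∀ {x y} → f x < f y → x < y) → ∀ {x} ys → Starts231 (f x) (map f ys) → Starts231 x ys
  Starts231-map⁻ reflect (y ∷ ys) (inj₁ (x<y , z<x)) = inj₁ (reflect x<y , Any.map reflect (Any.map⁻ z<x))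
  Starts231-map⁻ reflect (y ∷ ys) (inj₂ p)           = inj₂ (Starts231-map⁻ reflect ys p)

  Contains231-map⁻ : (∀ {x y} → f x < f y → x < y) → ∀ xs → Contains231ˡ (map f xs) → Contains231ˡ xs
  Contains231-map⁻ reflect (x ∷ xs) (inj₁ p) = inj₁ (Starts231-map⁻ reflect xs p)
  Contains231-map⁻ reflect (x ∷ xs) (inj₂ c) = inj₂ (Contains231-map⁻ reflect xs c)

replicate-avoids231 : ∀ n → Avoids231ˡ (replicate n 1)
replicate-avoids231 (suc n) (inj₁ p) = no-bigger (All.replicate⁺ n ≤-refl) (Starts231⇒bigger p)
replicate-avoids231 (suc n) (inj₂ c) = replicate-avoids231 n c

-- Cutting at the first maximum

-- With w = α M δ and δ = β shifted up by o, the height M - o of the peak is max β + 1,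
-- or max β when M reappears in δ.
heights : ℕ → List ℕ
heights zero    = 1 ∷ []
heights (suc k) = suc (suc k) ∷ suc k ∷ []

-- The shift o is s = max α, or s - 1 when s reappears in δ; since then s < M, the height is at least 2.
shifts : ℕ → ℕ → List ℕ
shifts zero    t             = 0 ∷ []
shifts (suc s) (suc (suc t)) = suc s ∷ s ∷ []
shifts (suc s) _             = suc s ∷ []

∈-heights⁻ : ∀ {t k} → t ∈ heights k → t ≡ suc k ⊎ (t ≡ k × 1 ≤ k)
∈-heights⁻ {k = zero}  (here refl)         = inj₁ refl
∈-heights⁻ {k = suc k} (here refl)         = inj₁ refl
∈-heights⁻ {k = suc k} (there (here refl)) = inj₂ (refl , s≤s z≤n)

∈-heights⁺ : ∀ {t k} → k ≤ t → t ≤ suc k → 1 ≤ t → t ∈ heights k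
∈-heights⁺ {t} {k} k≤t t≤1+k 1≤t with m≤n⇒m<n∨m≡n k≤t
∈-heights⁺ {k = zero}  _ t≤1+k _   | inj₁ k<t = here (≤-antisym t≤1+k k<t)
∈-heights⁺ {k = suc k} _ t≤1+k _   | inj₁ k<t = here (≤-antisym t≤1+k k<t)
∈-heights⁺ {k = suc k} _ _     _   | inj₂ refl = there (here refl)
∈-heights⁺ {k = zero}  _ _     1≤t | inj₂ refl = contradiction 1≤t λ ()

∈-shifts⁻ : ∀ {o s t} → o ∈ shifts s t → o ≡ s ⊎ (suc o ≡ s × 2 ≤ t)
∈-shifts⁻ {s = zero}                    (here refl)         = inj₁ refl
∈-shifts⁻ {s = suc s} {suc (suc t)}     (here refl)         = inj₁ refl
∈-shifts⁻ {s = suc s} {suc (suc t)}     (there (here refl)) = inj₂ (refl , s≤s (s≤s z≤n))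
∈-shifts⁻ {s = suc s} {zero}            (here refl)         = inj₁ refl
∈-shifts⁻ {s = suc s} {suc zero}        (here refl)         = inj₁ refl

∈-shifts⁺ : ∀ {o s t} → o ≡ s ⊎ (suc o ≡ s × 2 ≤ t) → o ∈ shifts s t
∈-shifts⁺ {s = zero}                (inj₁ refl)                  = here refl
∈-shifts⁺ {s = suc s} {suc (suc t)} (inj₁ refl)                  = here refl
∈-shifts⁺ {s = suc s} {zero}        (inj₁ refl)                  = here refl
∈-shifts⁺ {s = suc s} {suc zero}    (inj₁ refl)                  = here refl
∈-shifts⁺ {s = suc s} {suc (suc t)} (inj₂ (refl , _))            = there (here refl)
∈-shifts⁺ {s = suc s} {suc zero}    (inj₂ (refl , s≤s ()))
∈-shifts⁺ {s = suc s} {zero}        (inj₂ (refl , ()))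
∈-shifts⁺ {s = zero}                (inj₂ (() , _))

∈-heights⇒≥1 : ∀ {t k} → t ∈ heights k → 1 ≤ t
∈-heights⇒≥1 t∈ with ∈-heights⁻ t∈
... | inj₁ refl       = s≤s z≤n
... | inj₂ (refl , p) = p

∈-heights⇒≤ : ∀ {t k} → t ∈ heights k → k ≤ t
∈-heights⇒≤ t∈ with ∈-heights⁻ t∈
... | inj₁ refl       = n≤1+n _
... | inj₂ (refl , _) = ≤-refl

∈-shifts⇒≤ : ∀ {o s t} → o ∈ shifts s t → o ≤ s
∈-shifts⇒≤ o∈ with ∈-shifts⁻ o∈
... | inj₁ refl       = ≤-refl
... | inj₂ (refl , _) = n≤1+n _

∈-shifts⇒≤1+ : ∀ {o s t} → o ∈ shifts s t → s ≤ suc o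
∈-shifts⇒≤1+ o∈ with ∈-shifts⁻ o∈
... | inj₁ refl       = n≤1+n _
... | inj₂ (refl , _) = ≤-refl

∈-shifts⇒<+ : ∀ {o s t k} → t ∈ heights k → o ∈ shifts s t → s < t + o
∈-shifts⇒<+ {o} {s} t∈ o∈ with ∈-shifts⁻ o∈
... | inj₁ refl         = m<n+m s (∈-heights⇒≥1 t∈)
... | inj₂ (refl , 2≤t) = +-monoˡ-≤ o 2≤t

record Parts : Set where
  constructor parts
  field
    left   : List ℕ
    height : ℕ
    right  : List ℕ
    shift  : ℕ

glue : Parts → List ℕ
glue (parts α t β o) = α ++ (t + o) ∷ map (_+ o) β

Valid : Parts → Set
Valid (parts α t β o) =
  IsCayleyˡ α × IsCayleyˡ β × t ∈ heights (max 0 β) × o ∈ shifts (max 0 α) t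

module _ {α β : List ℕ} {t o : ℕ} (cα : IsCayleyˡ α) (cβ : IsCayleyˡ β)
         (t∈ : t ∈ heights (max 0 β)) (o∈ : o ∈ shifts (max 0 α) t) where

  private
    s k : ℕ
    s = max 0 α
    k = max 0 β

  max-left<peak : s < t + o
  max-left<peak = ∈-shifts⇒<+ t∈ o∈

  left<peak : All (_< t + o) α
  left<peak = All.map (λ a≤s → ≤-<-trans a≤s max-left<peak) (xs≤max 0 α)

  right≤peak : All (_≤ t + o) (map (_+ o) β)
  right≤peak = All.map⁺ (All.map (λ b≤k → +-monoˡ-≤ o (≤-trans b≤k (∈-heights⇒≤ t∈))) (xs≤max 0 β))

  max-glue : max 0 (glue (parts α t β o)) ≡ t + o
  max-glue = max-≡ (∈-++⁺ʳ α (here refl)) (All.++⁺ (All.map <⇒≤ left<peak) (≤-refl ∷ right≤peak))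

  glue-covers : ∀ j → 1 ≤ j → j ≤ t + o → j ∈ glue (parts α t β o)
  glue-covers j 1≤j j≤M with j ≤? s
  ... | yes j≤s = ∈-++⁺ˡ (proj₂ cα j 1≤j j≤s)
  ... | no  j≰s with j ≤? k + o
  ...   | yes j≤k+o =
    ∈-++⁺ʳ α (there (subst (_∈ map (_+ o) β) (m∸n+n≡m (<⇒≤ o<j)) (∈-map⁺ (_+ o) j∸o∈β)))
    where
    o<j : o < j
    o<j = ≤-<-trans (∈-shifts⇒≤ o∈) (≰⇒> j≰s)
    j∸o∈β : j ∸ o ∈ β
    j∸o∈β = proj₂ cβ (j ∸ o) (m<n⇒0<n∸m o<j) (subst (j ∸ o ≤_) (m+n∸n≡m k o) (∸-monoˡ-≤ o j≤k+o))
  ...   | no  j≰k+o = ∈-++⁺ʳ α (here j≡M)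
    where
    j≡M : j ≡ t + o
    j≡M with ∈-heights⁻ t∈
    ... | inj₁ refl       = ≤-antisym j≤M (≰⇒> j≰k+o)
    ... | inj₂ (refl , _) = contradiction j≤M j≰k+o

  glue-isCayley : IsCayleyˡ (glue (parts α t β o))
  glue-isCayley = positive , λ j 1≤j j≤max → glue-covers j 1≤j (subst (j ≤_) max-glue j≤max)
    where
    positive = All.++⁺ (proj₁ cα)
      (≤-trans (∈-heights⇒≥1 t∈) (m≤m+n t o)
        ∷ All.map⁺ (All.map (λ 1≤b → ≤-trans 1≤b (m≤m+n _ o)) (proj₁ cβ)))

  glue-avoids231 : Avoids231ˡ α → Avoids231ˡ β → Avoids231ˡ (glue (parts α t β o))
  glue-avoids231 aα aβ c with Contains231-++⁻ α ((t + o) ∷ map (_+ o) β) left≤rest c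
    where
    s≤b+o : ∀ {b} → 1 ≤ b → s ≤ b + o
    s≤b+o 1≤b = ≤-trans (∈-shifts⇒≤1+ o∈) (+-monoˡ-≤ o 1≤b)
    left≤rest : All (λ a → All (a ≤_) ((t + o) ∷ map (_+ o) β)) α
    left≤rest = All.map (λ a≤s → ≤-trans a≤s (<⇒≤ max-left<peak) ∷ All.map⁺ (All.map (≤-trans a≤s ∘ s≤b+o) (proj₁ cβ)))
                        (xs≤max 0 α)
  ... | inj₁ cα′ = aα cα′
  ... | inj₂ c′  =
    aβ (Contains231-map⁻ (_+ o) (λ {x} {y} → +-cancelʳ-< o x y) β (Contains231-∷-max _ right≤peak c′))

split-at-max-unique : ∀ xs xs′ {x x′ ys ys′} →
  All (_< x) xs → All (_< x′) xs′ → All (_≤ x) ys → All (_≤ x′) ys′ →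
  xs ++ x ∷ ys ≡ xs′ ++ x′ ∷ ys′ → xs ≡ xs′ × x ≡ x′ × ys ≡ ys′
split-at-max-unique []       []         _          _            _     _     refl = refl , refl , refl
split-at-max-unique []       (_ ∷ xs′) _          (u<x′ ∷ _)  ys≤x  _     refl =
  contradiction (All.lookup ys≤x (∈-++⁺ʳ xs′ (here refl))) (<⇒≱ u<x′)
split-at-max-unique (_ ∷ xs) []         (u<x ∷ _)  _            _     ys≤x′ refl =
  contradiction (All.lookup ys≤x′ (∈-++⁺ʳ xs (here refl))) (<⇒≱ u<x)
split-at-max-unique (u ∷ xs) (_ ∷ xs′) (_ ∷ xs<x) (_ ∷ xs′<x′) ys≤x  ys≤x′ eq
  with refl , eq′ ← ∷-injective eq
  with refl , refl , refl ← split-at-max-unique xs xs′ xs<x xs′<x′ ys≤x ys≤x′ eq′ = refl , refl , refl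

∈-heights-≥2⇒≥1 : ∀ {t k} → t ∈ heights k → 2 ≤ t → 1 ≤ k
∈-heights-≥2⇒≥1 t∈ 2≤t with ∈-heights⁻ t∈
... | inj₁ refl       = ≤-pred 2≤t
... | inj₂ (refl , p) = p

-- β′ contains 1, so the right-hand side contains 1 + o, which map (_+ suc o) β can only produce from a 0.
shifted-right-distinct : ∀ {o β β′} → All (1 ≤_) β → IsCayleyˡ β′ → 1 ≤ max 0 β′ →
                         map (_+ suc o) β ≢ map (_+ o) β′
shifted-right-distinct {o} pos cβ′ 1≤k eq
  with y , y∈β , 1+o≡y+1+o ←
         ∈-map⁻ (_+ suc o) (subst (suc o ∈_) (sym eq) (∈-map⁺ (_+ o) (proj₂ cβ′ 1 ≤-refl 1≤k))) =
  <⇒≢ (All.lookup pos y∈β) (sym (+-cancelʳ-≡ (suc o) y 0 (sym 1+o≡y+1+o)))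

shift-unique : ∀ {β β′ s t t′ o o′} → IsCayleyˡ β → IsCayleyˡ β′ →
               t ∈ heights (max 0 β) → t′ ∈ heights (max 0 β′) →
               o ∈ shifts s t → o′ ∈ shifts s t′ →
               map (_+ o) β ≡ map (_+ o′) β′ → o ≡ o′
shift-unique {β = β} {β′} {o = o} {o′} cβ cβ′ t∈ t′∈ o∈ o′∈ β+o≡β′+o′
  with ∈-shifts⁻ o∈ | ∈-shifts⁻ o′∈
... | inj₁ o≡s          | inj₁ o′≡s          = trans o≡s (sym o′≡s)
... | inj₂ (1+o≡s , _)  | inj₂ (1+o′≡s , _)  = suc-injective (trans 1+o≡s (sym 1+o′≡s))
... | inj₁ o≡s          | inj₂ (1+o′≡s , 2≤t′) =
  contradiction (subst (λ x → map (_+ x) β ≡ map (_+ o′) β′) (trans o≡s (sym 1+o′≡s)) β+o≡β′+o′)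
                (shifted-right-distinct (proj₁ cβ) cβ′ (∈-heights-≥2⇒≥1 t′∈ 2≤t′))
... | inj₂ (1+o≡s , 2≤t) | inj₁ o′≡s         =
  contradiction (subst (λ x → map (_+ x) β′ ≡ map (_+ o) β) (trans o′≡s (sym 1+o≡s)) (sym β+o≡β′+o′))
                (shifted-right-distinct (proj₁ cβ′) cβ (∈-heights-≥2⇒≥1 t∈ 2≤t))

glue-injective : ∀ {P P′} → Valid P → Valid P′ → glue P ≡ glue P′ → P ≡ P′
glue-injective {parts α t β o} {parts α′ t′ β′ o′} (cα , cβ , t∈ , o∈) (cα′ , cβ′ , t′∈ , o′∈) eq
  with refl , t+o≡t′+o′ , β+o≡β′+o′ ← split-at-max-unique α α′
         (left<peak cα cβ t∈ o∈) (left<peak cα′ cβ′ t′∈ o′∈)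
         (right≤peak cα cβ t∈ o∈) (right≤peak cα′ cβ′ t′∈ o′∈) eq
  with refl ← shift-unique cβ cβ′ t∈ t′∈ o∈ o′∈ β+o≡β′+o′
  with refl ← +-cancelʳ-≡ o t t′ t+o≡t′+o′
  with refl ← map-injective (λ {x} {y} → +-cancelʳ-≡ o x y) β+o≡β′+o′ = refl

Decomposition : List ℕ → Set
Decomposition w = Σ Parts λ P → Valid P × Avoids231ˡ (Parts.left P) × Avoids231ˡ (Parts.right P) × w ≡ glue P

first-occurrence : ∀ {m} w → m ∈ w → ∃₂ λ α δ → w ≡ α ++ m ∷ δ × All (_≢ m) α
first-occurrence {m} (x ∷ xs) m∈ with x ≟ m | m∈
... | yes refl | _           = [] , xs , refl , []
... | no  x≢m  | here refl   = contradiction refl x≢m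
... | no  x≢m  | there m∈xs  with α , δ , refl , α≢m ← first-occurrence xs m∈xs =
  x ∷ α , δ , refl , x≢m ∷ α≢m

shift-choice : ∀ s {δ} → All (1 ≤_) δ → Σ ℕ λ o → (o ≡ s × s ∉ δ) ⊎ (suc o ≡ s × s ∈ δ)
shift-choice s {δ} pos with s ∈? δ
shift-choice zero    pos | yes 0∈δ = contradiction (All.lookup pos 0∈δ) λ ()
shift-choice (suc s) pos | yes s∈δ = s , inj₂ (refl , s∈δ)
shift-choice s       pos | no  s∉δ = s , inj₁ (refl , s∉δ)

module Split {α δ : List ℕ} {M : ℕ} (cw : IsCayleyˡ (α ++ M ∷ δ)) (aw : Avoids231ˡ (α ++ M ∷ δ))
             (α<M : All (_< M) α) (δ≤M : All (_≤ M) δ) where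

  private
    s : ℕ
    s = max 0 α

  1≤M : 1 ≤ M
  1≤M = All.lookup (proj₁ cw) (∈-++⁺ʳ α (here refl))

  covers : ∀ j → 1 ≤ j → j ≤ M → j ∈ α ++ M ∷ δ
  covers j 1≤j j≤M = proj₂ cw j 1≤j (subst (j ≤_) (sym max≡M) j≤M)
    where
    max≡M = max-≡ (∈-++⁺ʳ α (here refl)) (All.++⁺ (All.map <⇒≤ α<M) (≤-refl ∷ δ≤M))

  left≤right : ∀ {a d} → a ∈ α → d ∈ δ → a ≤ d
  left≤right a∈ d∈ = ≮⇒≥ λ d<a → aw (Contains231-across α δ a∈ (All.lookup α<M a∈) d∈ d<a)

  max-left<M : s < M
  max-left<M = max<v⁺ 1≤M α<M

  max-left≤right : ∀ {d} → d ∈ δ → s ≤ d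
  max-left≤right d∈ = max≤ (All.tabulate λ a∈ → left≤right a∈ d∈)

  positive-right : All (1 ≤_) δ
  positive-right with All.++⁻ʳ α (proj₁ cw)
  ... | _ ∷ p = p

  left-isCayley : IsCayleyˡ α
  left-isCayley = All.++⁻ˡ α (proj₁ cw) , covers-left
    where
    covers-left : ∀ j → 1 ≤ j → j ≤ s → j ∈ α
    covers-left j 1≤j j≤s with ∈-++⁻ α (covers j 1≤j (≤-trans j≤s (<⇒≤ max-left<M)))
    ... | inj₁ j∈α         = j∈α
    ... | inj₂ (here refl) = contradiction j≤s (<⇒≱ max-left<M)
    ... | inj₂ (there j∈δ) = subst (_∈ α) (≤-antisym (max-left≤right j∈δ) j≤s) (max-∈ (≤-trans 1≤j j≤s))

  left-avoids231 : Avoids231ˡ α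
  left-avoids231 c = aw (Contains231-++ˡ α (M ∷ δ) c)

  right-avoids231 : Avoids231ˡ δ
  right-avoids231 c = aw (Contains231-++ʳ α (M ∷ δ) (inj₂ c))

  private
    o : ℕ
    o = proj₁ (shift-choice s positive-right)

  o-spec : (o ≡ s × s ∉ δ) ⊎ (suc o ≡ s × s ∈ δ)
  o-spec = proj₂ (shift-choice s positive-right)

  shift<right : ∀ {d} → d ∈ δ → o < d
  shift<right {d} d∈ with o-spec
  ... | inj₁ (o≡s , s∉δ) = subst (_< d) (sym o≡s) (≤∧≢⇒< (max-left≤right d∈) λ { refl → s∉δ d∈ })
  ... | inj₂ (1+o≡s , _) = subst (_≤ d) (sym 1+o≡s) (max-left≤right d∈)

  shift<M : o < M
  shift<M with o-spec
  ... | inj₁ (o≡s , _)   = subst (_< M) (sym o≡s) max-left<M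
  ... | inj₂ (1+o≡s , _) = <-trans (subst (o <_) 1+o≡s ≤-refl) max-left<M

  -- Everything strictly between the shift and M occurs in δ: above s it cannot be in α,
  -- and s itself is only above the shift when it reappears in δ.
  between-in-right : ∀ j → o < j → j < M → j ∈ δ
  between-in-right j o<j j<M with ∈-++⁻ α (covers j (≤-trans (s≤s z≤n) o<j) (<⇒≤ j<M))
  ... | inj₂ (there j∈δ) = j∈δ
  ... | inj₂ (here refl) = contradiction j<M (<-irrefl refl)
  ... | inj₁ j∈α with o-spec
  ...   | inj₁ (o≡s , _)     = contradiction (subst (_< j) o≡s o<j) (≤⇒≯ (∈⇒≤max j∈α))
  ...   | inj₂ (1+o≡s , s∈δ) = subst (_∈ δ) (≤-antisym (subst (_≤ j) 1+o≡s o<j) (∈⇒≤max j∈α)) s∈δ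

  private
    β : List ℕ
    β = map (_∸ o) δ
    t : ℕ
    t = M ∸ o

  right-unshift : map (_+ o) β ≡ δ
  right-unshift = trans (sym (map-∘ δ)) (map-id-local (All.tabulate λ d∈ → m∸n+n≡m (<⇒≤ (shift<right d∈))))

  peak-unshift : t + o ≡ M
  peak-unshift = m∸n+n≡m (<⇒≤ shift<M)

  ∈-right⁻ : ∀ {j} → j + o ∈ δ → j ∈ β
  ∈-right⁻ {j} j+o∈δ = subst (_∈ β) (m+n∸n≡m j o) (∈-map⁺ (_∸ o) j+o∈δ)

  max-right≤height : max 0 β ≤ t
  max-right≤height = max≤ (All.map⁺ (All.map (∸-monoˡ-≤ o) δ≤M))

  right-isCayley : IsCayleyˡ β
  right-isCayley = All.map⁺ (All.tabulate λ d∈ → m<n⇒0<n∸m (shift<right d∈)) , covers-right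
    where
    covers-right : ∀ j → 1 ≤ j → j ≤ max 0 β → j ∈ β
    covers-right j 1≤j j≤k with m≤n⇒m<n∨m≡n j≤k
    ... | inj₂ refl = max-∈ 1≤j
    ... | inj₁ j<k  = ∈-right⁻ (between-in-right (j + o) (m<n+m o 1≤j) j+o<M)
      where
      j+o<M = subst (j + o <_) peak-unshift (+-monoˡ-< o (<-≤-trans j<k max-right≤height))

  height≤1+max-right : t ≤ suc (max 0 β)
  height≤1+max-right = bound t peak-unshift
    where
    bound : ∀ u → u + o ≡ M → u ≤ suc (max 0 β)
    bound zero          _     = z≤n
    bound (suc zero)    _     = s≤s z≤n
    bound (suc (suc u)) u+o≡M =
      s≤s (∈⇒≤max (∈-right⁻ (between-in-right (suc u + o) (m<n+m o (s≤s z≤n)) 1+u+o<M)))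
      where 1+u+o<M = subst (suc u + o <_) u+o≡M ≤-refl

  split : Decomposition (α ++ M ∷ δ)
  split = parts α t β o
        , (left-isCayley , right-isCayley , t∈heights , o∈shifts)
        , left-avoids231 , shifted-avoids231
        , cong (α ++_) (cong₂ _∷_ (sym peak-unshift) (sym right-unshift))
    where
    t∈heights = ∈-heights⁺ max-right≤height height≤1+max-right (m<n⇒0<n∸m shift<M)
    o∈shifts : o ∈ shifts s t
    o∈shifts with o-spec
    ... | inj₁ (o≡s , _)   = ∈-shifts⁺ (inj₁ o≡s)
    ... | inj₂ (1+o≡s , _) = ∈-shifts⁺ (inj₂ (1+o≡s , m+n≤o⇒m≤o∸n 2 (subst (_< M) (sym 1+o≡s) max-left<M)))
    shifted-avoids231 : Avoids231ˡ β
    shifted-avoids231 c = right-avoids231 (subst Contains231ˡ right-unshift (Contains231-map⁺ (_+ o) (+-monoˡ-< o) β c))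

glue-surjective : ∀ {x xs} → IsCayleyˡ (x ∷ xs) → Avoids231ˡ (x ∷ xs) → Decomposition (x ∷ xs)
glue-surjective {x} {xs} cw aw = split-at (first-occurrence (x ∷ xs) (max-∈ 1≤M))
  where
  M = max 0 (x ∷ xs)
  1≤M : 1 ≤ M
  1≤M = ≤-trans (All.lookup (proj₁ cw) (here refl)) (∈⇒≤max {xs = x ∷ xs} (here refl))
  split-at : (∃₂ λ α δ → x ∷ xs ≡ α ++ M ∷ δ × All (_≢ M) α) → Decomposition (x ∷ xs)
  split-at (α , δ , w≡ , α≢M) =
    let P , valid , aα , aβ , eq = Split.split (subst IsCayleyˡ w≡ cw) (subst Avoids231ˡ w≡ aw) α<M δ≤M
    in  P , valid , aα , aβ , trans w≡ eq
    where
    ≤M : All (_≤ M) (α ++ M ∷ δ)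
    ≤M = subst (All (_≤ M)) w≡ (xs≤max 0 (x ∷ xs))
    α<M : All (_< M) α
    α<M = All.zipWith (λ (a≤M , a≢M) → ≤∧≢⇒< a≤M a≢M) (All.++⁻ˡ α ≤M , α≢M)
    δ≤M : All (_≤ M) δ
    δ≤M = All.tail (All.++⁻ʳ α ≤M)

-- Enumeration

choicesFor : List ℕ → List ℕ → List Parts
choicesFor α β = concatMap (λ t → map (parts α t β) (shifts (max 0 α) t)) (heights (max 0 β))

layer : (ℕ → List (List ℕ)) → ℕ → ℕ → List Parts
layer A n i = concatMap (λ α → concatMap (choicesFor α) (A i)) (A (n ∸ i))

candidates : (ℕ → List (List ℕ)) → ℕ → List Parts
candidates A n = concatMap (layer A n) (upTo (suc n))

-- The first argument is fuel making the recursion structural; avoiders f n is correct once n ≤ f.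
avoiders : ℕ → ℕ → List (List ℕ)
avoiders _       zero    = [] ∷ []
avoiders zero    (suc n) = []
avoiders (suc f) (suc n) = map glue (candidates (avoiders f) n)

∈-choicesFor⁻ : ∀ {α β P} → P ∈ choicesFor α β →
  ∃₂ λ t o → t ∈ heights (max 0 β) × o ∈ shifts (max 0 α) t × P ≡ parts α t β o
∈-choicesFor⁻ {α} {β} P∈
  with t , t∈ , P∈′ ← ∈-concatMap⁻′ (λ t → map (parts α t β) (shifts (max 0 α) t)) (heights (max 0 β)) P∈
  with o , o∈ , refl ← ∈-map⁻ (parts α t β) P∈′ = t , o , t∈ , o∈ , refl

∈-choicesFor⁺ : ∀ {α β t o} → t ∈ heights (max 0 β) → o ∈ shifts (max 0 α) t →
                parts α t β o ∈ choicesFor α β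
∈-choicesFor⁺ {α} {β} t∈ o∈ =
  ∈-concatMap⁺′ (λ t → map (parts α t β) (shifts (max 0 α) t)) t∈ (∈-map⁺ (parts α _ β) o∈)

record Candidate (A : ℕ → List (List ℕ)) (n : ℕ) (P : Parts) : Set where
  constructor candidate
  open Parts P
  field
    rightLength : ℕ
    ≤n          : rightLength ≤ n
    left∈       : left ∈ A (n ∸ rightLength)
    right∈      : right ∈ A rightLength
    height∈     : height ∈ heights (max 0 right)
    shift∈      : shift ∈ shifts (max 0 left) height

∈-candidates⁻ : ∀ {A n P} → P ∈ candidates A n → Candidate A n P
∈-candidates⁻ {A} {n} P∈
  with i , i∈ , P∈ᵢ ← ∈-concatMap⁻′ (layer A n) (upTo (suc n)) P∈
  with α , α∈ , P∈α ← ∈-concatMap⁻′ (λ α → concatMap (choicesFor α) (A i)) (A (n ∸ i)) P∈ᵢ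
  with β , β∈ , P∈αβ ← ∈-concatMap⁻′ (choicesFor α) (A i) P∈α
  with t , o , t∈ , o∈ , refl ← ∈-choicesFor⁻ {α} {β} P∈αβ
  = candidate i (≤-pred (∈-upTo⁻ i∈)) α∈ β∈ t∈ o∈

∈-candidates⁺ : ∀ {A n P} → Candidate A n P → P ∈ candidates A n
∈-candidates⁺ {A} {n} {parts α t β o} (candidate i i≤n α∈ β∈ t∈ o∈) =
  ∈-concatMap⁺′ (layer A n) (∈-upTo⁺ (s≤s i≤n))
    (∈-concatMap⁺′ (λ α → concatMap (choicesFor α) (A i)) α∈
      (∈-concatMap⁺′ (choicesFor α) β∈ (∈-choicesFor⁺ t∈ o∈)))

unique-heights : ∀ k → Unique (heights k)
unique-heights zero    = [] ∷ []
unique-heights (suc k) = ((λ ()) ∷ []) ∷ [] ∷ []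

unique-shifts : ∀ s t → Unique (shifts s t)
unique-shifts zero    t             = [] ∷ []
unique-shifts (suc s) (suc (suc t)) = ((λ ()) ∷ []) ∷ [] ∷ []
unique-shifts (suc s) zero          = [] ∷ []
unique-shifts (suc s) (suc zero)    = [] ∷ []

choicesFor-left : ∀ {α β P} → P ∈ choicesFor α β → Parts.left P ≡ α
choicesFor-left {α} {β} P∈ = let _ , _ , _ , _ , P≡ = ∈-choicesFor⁻ {α} {β} P∈ in cong Parts.left P≡

choicesFor-right : ∀ {α β P} → P ∈ choicesFor α β → Parts.right P ≡ β
choicesFor-right {α} {β} P∈ = let _ , _ , _ , _ , P≡ = ∈-choicesFor⁻ {α} {β} P∈ in cong Parts.right P≡

unique-choicesFor : ∀ α β → Unique (choicesFor α β)
unique-choicesFor α β =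
  Unique-concatMap⁺ Parts.height (λ t → map (parts α t β) (shifts (max 0 α) t)) (unique-heights (max 0 β))
    (λ {t} _ → Unique.map⁺ (cong Parts.shift) (unique-shifts (max 0 α) t))
    (λ {t} _ P∈ → let _ , _ , P≡ = ∈-map⁻ (parts α t β) P∈ in cong Parts.height P≡)

AvoidingCayley : ℕ → List ℕ → Set
AvoidingCayley n w = length w ≡ n × IsCayleyˡ w × Avoids231ˡ w

record Enumerates (n : ℕ) (ws : List (List ℕ)) : Set where
  field
    sound    : ∀ {w} → w ∈ ws → AvoidingCayley n w
    complete : ∀ {w} → AvoidingCayley n w → w ∈ ws
    unique   : Unique ws

enumerates-[] : Enumerates 0 ([] ∷ [])
enumerates-[] = record
  { sound    = λ { (here refl) → refl , ([] , λ j 1≤j j≤0 → contradiction j≤0 (<⇒≱ 1≤j)) , λ () }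
  ; complete = λ { {[]} _ → here refl }
  ; unique   = [] ∷ []
  }

length-glue : ∀ α t β o → length (glue (parts α t β o)) ≡ length α + suc (length β)
length-glue α t β o = begin
  length (α ++ (t + o) ∷ map (_+ o) β) ≡⟨ length-++ α ⟩
  length α + suc (length (map (_+ o) β)) ≡⟨ cong (λ l → length α + suc l) (length-map (_+ o) β) ⟩
  length α + suc (length β) ∎
  where open ≡-Reasoning

module Step (A : ℕ → List (List ℕ)) (n : ℕ) (IH : ∀ i → i ≤ n → Enumerates i (A i)) where

  open Enumerates

  private
    IHˡ : ∀ i → Enumerates (n ∸ i) (A (n ∸ i))
    IHˡ i = IH (n ∸ i) (m∸n≤m n i)

  candidate-valid : ∀ {P} → P ∈ candidates A n → Valid P
  candidate-valid P∈ =
    let open Candidate (∈-candidates⁻ {A} P∈)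
        _ , cα , _ = sound (IHˡ rightLength) left∈
        _ , cβ , _ = sound (IH rightLength ≤n) right∈
    in  cα , cβ , height∈ , shift∈

  glue-sound : ∀ {P} → P ∈ candidates A n → AvoidingCayley (suc n) (glue P)
  glue-sound {parts α t β o} P∈ =
    let open Candidate (∈-candidates⁻ {A} P∈)
        |α| , cα , aα = sound (IHˡ rightLength) left∈
        |β| , cβ , aβ = sound (IH rightLength ≤n) right∈
    in  length≡ ≤n |α| |β|
      , glue-isCayley cα cβ height∈ shift∈
      , glue-avoids231 cα cβ height∈ shift∈ aα aβ
    where
    length≡ : ∀ {i} → i ≤ n → length α ≡ n ∸ i → length β ≡ i →
              length (glue (parts α t β o)) ≡ suc n
    length≡ {i} i≤n |α| |β| = begin
      length (glue (parts α t β o)) ≡⟨ length-glue α t β o ⟩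
      length α + suc (length β)     ≡⟨ cong₂ (λ l r → l + suc r) |α| |β| ⟩
      n ∸ i + suc i                 ≡⟨ +-suc (n ∸ i) i ⟩
      suc (n ∸ i + i)               ≡⟨ cong suc (m∸n+n≡m i≤n) ⟩
      suc n                         ∎
      where open ≡-Reasoning

  glue-complete : ∀ {w} → AvoidingCayley (suc n) w → w ∈ map glue (candidates A n)
  glue-complete {x ∷ xs} (|w| , cw , aw) = from-split (glue-surjective cw aw)
    where
    from-split : Decomposition (x ∷ xs) → x ∷ xs ∈ map glue (candidates A n)
    from-split (parts α t β o , (cα , cβ , t∈ , o∈) , aα , aβ , w≡) =
      subst (_∈ map glue (candidates A n)) (sym w≡)
        (∈-map⁺ glue (∈-candidates⁺ {A} (candidate (length β) |β|≤n α∈ β∈ t∈ o∈)))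
      where
      |α|+|β| : length α + length β ≡ n
      |α|+|β| = suc-injective (begin
        suc (length α + length β)     ≡⟨ +-suc (length α) (length β) ⟨
        length α + suc (length β)     ≡⟨ length-glue α t β o ⟨
        length (glue (parts α t β o)) ≡⟨ cong length w≡ ⟨
        length (x ∷ xs)               ≡⟨ |w| ⟩
        suc n                         ∎)
        where open ≡-Reasoning
      |β|≤n = subst (length β ≤_) |α|+|β| (m≤n+m (length β) (length α))
      |α| = trans (sym (m+n∸n≡m (length α) (length β))) (cong (_∸ length β) |α|+|β|)
      α∈ = complete (IHˡ (length β)) (|α| , cα , aα)
      β∈ = complete (IH (length β) |β|≤n) (refl , cβ , aβ)

  unique-candidates : Unique (candidates A n)
  unique-candidates = Unique-concatMap⁺ (length ∘ Parts.right) _ (Unique.upTo⁺ (suc n))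
    (λ i∈ → unique-layer (≤-pred (∈-upTo⁻ i∈)))
    (λ i∈ P∈ → layer-right-length (≤-pred (∈-upTo⁻ i∈)) P∈)
    where
    unique-layer : ∀ {i} → i ≤ n → Unique (layer A n i)
    unique-layer {i} i≤n = Unique-concatMap⁺ Parts.left _ (unique (IHˡ i))
      (λ {α} _ → Unique-concatMap⁺ Parts.right (choicesFor α) (unique (IH i i≤n))
                   (λ {β} _ → unique-choicesFor α β) (λ {β} _ → choicesFor-right {α} {β}))
      (λ {α} _ P∈ → let β , _ , P∈αβ = ∈-concatMap⁻′ (choicesFor α) (A i) P∈
                    in  choicesFor-left {α} {β} P∈αβ)

    layer-right-length : ∀ {i P} → i ≤ n → P ∈ layer A n i → length (Parts.right P) ≡ i
    layer-right-length {i} i≤n P∈ =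
      let α , _ , P∈α   = ∈-concatMap⁻′ (λ α → concatMap (choicesFor α) (A i)) (A (n ∸ i)) P∈
          β , β∈ , P∈αβ = ∈-concatMap⁻′ (choicesFor α) (A i) P∈α
      in  trans (cong length (choicesFor-right {α} {β} P∈αβ)) (proj₁ (sound (IH i i≤n) β∈))

  enumerates : Enumerates (suc n) (map glue (candidates A n))
  enumerates = record
    { sound    = λ w∈ → let P , P∈ , w≡ = ∈-map⁻ glue w∈
                        in  subst (AvoidingCayley (suc n)) (sym w≡) (glue-sound P∈)
    ; complete = glue-complete
    ; unique   = Unique-map⁺-∈ glue unique-candidates
                   λ P∈ P′∈ → glue-injective (candidate-valid P∈) (candidate-valid P′∈)
    }

avoiders-enumerate : ∀ {f n} → n ≤ f → Enumerates n (avoiders f n)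
avoiders-enumerate {f}     {zero}  _         = enumerates-[]
avoiders-enumerate {suc f} {suc n} (s≤s n≤f) =
  Step.enumerates (avoiders f) n λ i i≤n → avoiders-enumerate (≤-trans i≤n n≤f)

-- Words as vectors

lookup∈toList : ∀ {n} (v : Vec ℕ n) i → lookup v i ∈ toList v
lookup∈toList v i = Vec∈.∈-toList⁺ (Vec∈.∈-lookup i v)

Any-toList⇒lookup : ∀ {P : ℕ → Set} {n} (v : Vec ℕ n) → Any P (toList v) → ∃ λ i → P (lookup v i)
Any-toList⇒lookup v p = let q = VecAny.toList⁻ p in VecAny.index q , VecAny.lookup-index q

All-lookup⇒toList : ∀ {P : ℕ → Set} {n} (v : Vec ℕ n) → (∀ i → P (lookup v i)) → All P (toList v)
All-lookup⇒toList {P} v p = All.tabulate λ x∈ → let i , x≡ = Any-toList⇒lookup v x∈ in subst P (sym x≡) (p i)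

IsCayleyˡ⇒max≤length : ∀ {w} → IsCayleyˡ w → max 0 w ≤ length w
IsCayleyˡ⇒max≤length {w} (_ , covers) = subst (_≤ length w) (length-applyUpTo suc (max 0 w))
  (Unique-⊆⇒length≤ (Unique.applyUpTo⁺₁ suc (max 0 w) λ i<j _ → <⇒≢ i<j ∘ suc-injective) [1,max]⊆w)
  where
  [1,max]⊆w : ∀ {j} → j ∈ applyUpTo suc (max 0 w) → j ∈ w
  [1,max]⊆w j∈ = let i , i<max , j≡ = ∈-applyUpTo⁻ suc j∈
                 in  subst (_∈ w) (sym j≡) (covers (suc i) (s≤s z≤n) i<max)

IsCayley⇒IsCayleyˡ : ∀ {n} (v : Vec ℕ n) → IsCayley v → IsCayleyˡ (toList v)
IsCayley⇒IsCayleyˡ v (k , bounds , hits) = All-lookup⇒toList v (proj₁ ∘ bounds) , covers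
  where
  max≤k : max 0 (toList v) ≤ toℕ k
  max≤k = max≤ (All-lookup⇒toList v (proj₂ ∘ bounds))
  covers : ∀ j → 1 ≤ j → j ≤ max 0 (toList v) → j ∈ toList v
  covers (suc j) _ j<max =
    let j<k = ≤-trans j<max max≤k
        i , vᵢ≡ = hits (fromℕ< j<k)
    in  subst (_∈ toList v) (trans vᵢ≡ (cong suc (toℕ-fromℕ< j<k))) (lookup∈toList v i)

IsCayleyˡ⇒IsCayley : ∀ {n} (v : Vec ℕ n) → IsCayleyˡ (toList v) → IsCayley v
IsCayleyˡ⇒IsCayley {n} v c@(positive , covers) = fromℕ< (s≤s max≤n) , bounds , hits
  where
  max≤n : max 0 (toList v) ≤ n
  max≤n = subst (max 0 (toList v) ≤_) (length-toList v) (IsCayleyˡ⇒max≤length c)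
  k≡max = toℕ-fromℕ< (s≤s max≤n)
  bounds : ∀ i → 1 ≤ lookup v i × lookup v i ≤ toℕ (fromℕ< (s≤s max≤n))
  bounds i = All.lookup positive (lookup∈toList v i)
           , subst (lookup v i ≤_) (sym k≡max) (∈⇒≤max (lookup∈toList v i))
  hits : ∀ (j : Fin (toℕ (fromℕ< (s≤s max≤n)))) → Σ (Fin n) λ i → lookup v i ≡ suc (toℕ j)
  hits j = let i , vᵢ≡ = Any-toList⇒lookup v (covers (suc (toℕ j)) (s≤s z≤n) (subst (toℕ j <_) k≡max (toℕ<n j)))
           in  i , sym vᵢ≡

Starts231-from : ∀ {n x} (v : Vec ℕ n) (j k : Fin n) → toℕ j < toℕ k → lookup v k < x → x < lookup v j →
                 Starts231 x (toList v)
Starts231-from (y ∷ v) fzero    (fsuc k) _          vₖ<x x<vⱼ =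
  inj₁ (x<vⱼ , Any.map (λ { refl → vₖ<x }) (lookup∈toList v k))
Starts231-from (y ∷ v) (fsuc j) (fsuc k) (s≤s j<k) vₖ<x x<vⱼ = inj₂ (Starts231-from v j k j<k vₖ<x x<vⱼ)

Starts231-to : ∀ {n x} (v : Vec ℕ n) → Starts231 x (toList v) →
               Σ (Fin n) λ j → Σ (Fin n) λ k → toℕ j < toℕ k × lookup v k < x × x < lookup v j
Starts231-to (y ∷ v) (inj₁ (x<y , smaller)) = let k , vₖ<x = Any-toList⇒lookup v smaller in
  fzero , fsuc k , s≤s z≤n , vₖ<x , x<y
Starts231-to (y ∷ v) (inj₂ p) = let j , k , j<k , vₖ<x , x<vⱼ = Starts231-to v p in
  fsuc j , fsuc k , s≤s j<k , vₖ<x , x<vⱼ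

Contains231⇒Contains231ˡ : ∀ {n} (v : Vec ℕ n) → Contains231 v → Contains231ˡ (toList v)
Contains231⇒Contains231ˡ (x ∷ v) (_ , fzero , _ , () , _)
Contains231⇒Contains231ˡ (x ∷ v) (_ , fsuc j , fzero , _ , () , _)
Contains231⇒Contains231ˡ (x ∷ v) (fzero , fsuc j , fsuc k , _ , s≤s j<k , vₖ<vᵢ , vᵢ<vⱼ) =
  inj₁ (Starts231-from v j k j<k vₖ<vᵢ vᵢ<vⱼ)
Contains231⇒Contains231ˡ (x ∷ v) (fsuc i , fsuc j , fsuc k , s≤s i<j , s≤s j<k , vₖ<vᵢ , vᵢ<vⱼ) =
  inj₂ (Contains231⇒Contains231ˡ v (i , j , k , i<j , j<k , vₖ<vᵢ , vᵢ<vⱼ))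

Contains231ˡ⇒Contains231 : ∀ {n} (v : Vec ℕ n) → Contains231ˡ (toList v) → Contains231 v
Contains231ˡ⇒Contains231 (x ∷ v) (inj₁ p) = let j , k , j<k , vₖ<x , x<vⱼ = Starts231-to v p in
  fzero , fsuc j , fsuc k , s≤s z≤n , s≤s j<k , vₖ<x , x<vⱼ
Contains231ˡ⇒Contains231 (x ∷ v) (inj₂ c) =
  let i , j , k , i<j , j<k , vₖ<vᵢ , vᵢ<vⱼ = Contains231ˡ⇒Contains231 v c in
  fsuc i , fsuc j , fsuc k , s≤s i<j , s≤s j<k , vₖ<vᵢ , vᵢ<vⱼ

∈-words⁺ : ∀ {n} m (v : Vec ℕ n) → All (_< m) (toList v) → v ∈ words n m
∈-words⁺ m []      _            = here refl
∈-words⁺ m (x ∷ v) (x<m ∷ v<m) =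
  ∈-concatMap⁺′ (λ x → map (x ∷_) (words _ m)) (∈-upTo⁺ x<m) (∈-map⁺ (x ∷_) (∈-words⁺ m v v<m))

unique-words : ∀ n m → Unique (words n m)
unique-words zero    m = [] ∷ []
unique-words (suc n) m = Unique-concatMap⁺ head (λ x → map (x ∷_) (words n m)) (Unique.upTo⁺ m)
  (λ _ → Unique.map⁺ (λ { refl → refl }) (unique-words n m))
  (λ {x} _ v∈ → let _ , _ , v≡ = ∈-map⁻ (x ∷_) v∈ in cong head v≡)

Enumerates⇒length≡a : ∀ {n ws} → Enumerates n ws → length ws ≡ a n
Enumerates⇒length≡a {n} {ws} e = begin
  length ws           ≡⟨ Unique-⊆⊇⇒length≡ (unique e) unique-toLists ws⊆ ws⊇ ⟩
  length (map toList F) ≡⟨ length-map toList F ⟩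
  a n                 ∎
  where
  open ≡-Reasoning
  open Enumerates
  F = filter cayley231? (words n (suc n))

  unique-toLists : Unique (map toList F)
  unique-toLists = Unique.map⁺ (λ {v} {v′} eq → trans (sym (cast-is-id refl v)) (toList-injective refl v v′ eq))
                               (Unique.filter⁺ cayley231? (unique-words n (suc n)))

  ws⊇ : ∀ {w} → w ∈ map toList F → w ∈ ws
  ws⊇ w∈ with v , v∈F , refl ← ∈-map⁻ toList w∈ =
    let _ , isCayley , avoids = ∈-filter⁻ cayley231? {xs = words n (suc n)} v∈F
    in  complete e (length-toList v , IsCayley⇒IsCayleyˡ v isCayley , avoids ∘ Contains231ˡ⇒Contains231 v)

  ws⊆ : ∀ {w} → w ∈ ws → w ∈ map toList F
  ws⊆ {w} w∈ with |w| , cw , aw ← sound e w∈ with refl ← |w| =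
    subst (_∈ map toList F) (toList∘fromList w)
      (∈-map⁺ toList (∈-filter⁺ cayley231? (∈-words⁺ (suc n) v v<1+n) (isC , avoids)))
    where
    v = fromList w
    cv : IsCayleyˡ (toList v)
    cv = subst IsCayleyˡ (sym (toList∘fromList w)) cw
    isC = IsCayleyˡ⇒IsCayley v cv
    avoids = λ c → aw (subst Contains231ˡ (toList∘fromList w) (Contains231⇒Contains231ˡ v c))
    v<1+n = All.tabulate λ x∈ →
      s≤s (≤-trans (∈⇒≤max x∈) (subst (max 0 (toList v) ≤_) (length-toList v) (IsCayleyˡ⇒max≤length cv)))

-- Counting

choices : ℕ → ℕ → ℕ
choices s k = sum (map (λ t → length (shifts s t)) (heights k))

choicesOver : ℕ → List (List ℕ) → ℕ
choicesOver s ws = sum (map (choices s ∘ max 0) ws)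

length-choicesFor : ∀ α β → length (choicesFor α β) ≡ choices (max 0 α) (max 0 β)
length-choicesFor α β = trans (length-concatMap _ (heights (max 0 β)))
  (cong sum (map-cong (λ t → length-map (parts α t β) (shifts (max 0 α) t)) (heights (max 0 β))))

choices-positive : ∀ {s} k → 1 ≤ s → choices s k ≡ choices 1 k
choices-positive {suc s} zero          _ = refl
choices-positive {suc s} (suc zero)    _ = refl
choices-positive {suc s} (suc (suc k)) _ = refl

choices-0 : ∀ k → 1 ≤ k → choices 0 k ≡ 2
choices-0 (suc k) _ = refl

choices-1 : ∀ k → 1 ≤ k → choices 1 k + (if does (k ≟ 1) then 1 else 0) ≡ 4
choices-1 (suc zero)    _ = refl
choices-1 (suc (suc k)) _ = refl

replicate-isCayley : ∀ i → IsCayleyˡ (replicate i 1)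
replicate-isCayley i = All.replicate⁺ i ≤-refl , covers i
  where
  covers : ∀ i j → 1 ≤ j → j ≤ max 0 (replicate i 1) → j ∈ replicate i 1
  covers zero    j 1≤j j≤0 = contradiction j≤0 (<⇒≱ 1≤j)
  covers (suc i) j 1≤j j≤max =
    here (≤-antisym (subst (j ≤_) (max-≡ (here refl) (All.replicate⁺ (suc i) ≤-refl)) j≤max) 1≤j)

max≡1⇒replicate : ∀ {β} → All (1 ≤_) β → max 0 β ≡ 1 → β ≡ replicate (length β) 1
max≡1⇒replicate {β} positive max≡1 = go β positive (All.tabulate λ x∈ → subst (_ ≤_) max≡1 (∈⇒≤max x∈))
  where
  go : ∀ β → All (1 ≤_) β → All (_≤ 1) β → β ≡ replicate (length β) 1
  go []      _             _              = refl
  go (x ∷ β) (1≤x ∷ 1≤β) (x≤1 ∷ β≤1) = cong₂ _∷_ (≤-antisym x≤1 1≤x) (go β 1≤β β≤1)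

module _ {i ws} (e : Enumerates i ws) where

  open Enumerates e

  replicate∈ : replicate i 1 ∈ ws
  replicate∈ = complete (length-replicate i , replicate-isCayley i , replicate-avoids231 i)

  max-positive : 1 ≤ i → ∀ {β} → β ∈ ws → 1 ≤ max 0 β
  max-positive 1≤i {β} β∈ = go β (proj₁ (sound β∈)) (proj₁ (proj₁ (proj₂ (sound β∈))))
    where
    go : ∀ β → length β ≡ i → All (1 ≤_) β → 1 ≤ max 0 β
    go []      refl _           = contradiction 1≤i λ ()
    go (x ∷ β) _    (1≤x ∷ _) = ≤-trans 1≤x (∈⇒≤max {xs = x ∷ β} (here refl))

  count-max≡1 : 1 ≤ i → length (filter (λ β → max 0 β ≟ 1) ws) ≡ 1
  count-max≡1 1≤i = Unique-⊆⊇⇒length≡ (Unique.filter⁺ _ unique) ([] ∷ []) only-ones ones∈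
    where
    only-ones : ∀ {β} → β ∈ filter (λ β → max 0 β ≟ 1) ws → β ∈ replicate i 1 ∷ []
    only-ones β∈ =
      let β∈ws , max≡1 = ∈-filter⁻ (λ β → max 0 β ≟ 1) β∈
          |β| , (positive , _) , _ = sound β∈ws
      in  here (trans (max≡1⇒replicate positive max≡1) (cong (λ l → replicate l 1) |β|))
    ones∈ : ∀ {β} → β ∈ replicate i 1 ∷ [] → β ∈ filter (λ β → max 0 β ≟ 1) ws
    ones∈ (here refl) = ∈-filter⁺ (λ β → max 0 β ≟ 1) replicate∈ (max-replicate i 1≤i)
      where
      max-replicate : ∀ i → 1 ≤ i → max 0 (replicate i 1) ≡ 1
      max-replicate (suc i) _ = max-≡ (here refl) (All.replicate⁺ (suc i) ≤-refl)

  choicesOver-1 : 1 ≤ i → choicesOver 1 ws + 1 ≡ 4 * length ws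
  choicesOver-1 1≤i = begin
    sum (map c ws) + 1                   ≡⟨ cong (sum (map c ws) +_) (count-max≡1 1≤i) ⟨
    sum (map c ws) + length (filter P? ws) ≡⟨ cong (sum (map c ws) +_) (sum-indicator P? ws) ⟨
    sum (map c ws) + sum (map [P] ws)    ≡⟨ sum-map-+ c [P] ws ⟨
    sum (map (λ β → c β + [P] β) ws)     ≡⟨ sum-map-cong-∈ ws (λ β∈ → choices-1 _ (max-positive 1≤i β∈)) ⟩
    sum (map (λ _ → 4) ws)               ≡⟨ sum-map-const ws 4 ⟩
    length ws * 4                        ≡⟨ *-comm (length ws) 4 ⟩
    4 * length ws                        ∎
    where
    open ≡-Reasoning
    c : List ℕ → ℕ
    c β = choices 1 (max 0 β)
    P? = λ β → max 0 β ≟ 1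
    [P] : List ℕ → ℕ
    [P] β = if does (P? β) then 1 else 0

  choicesOver-0 : 1 ≤ i → choicesOver 0 ws ≡ length ws * 2
  choicesOver-0 1≤i = trans (sum-map-cong-∈ ws λ β∈ → choices-0 _ (max-positive 1≤i β∈)) (sum-map-const ws 2)

  choicesOver-empty : ∀ s → i ≡ 0 → choicesOver s ws ≡ length ws * choices s 0
  choicesOver-empty s refl = trans (sum-map-cong-∈ {g = λ _ → choices s 0} ws all-empty) (sum-map-const ws (choices s 0))
    where
    all-empty : ∀ {β} → β ∈ ws → choices s (max 0 β) ≡ choices s 0
    all-empty {β} β∈ = cong (choices s ∘ max 0) (length≡0⇒[] {xs = β} (proj₁ (sound β∈)))

module Layers (A : ℕ → List (List ℕ)) (n : ℕ) (IH : ∀ i → i ≤ n → Enumerates i (A i)) where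

  private
    IHˡ : ∀ i → Enumerates (n ∸ i) (A (n ∸ i))
    IHˡ i = IH (n ∸ i) (m∸n≤m n i)

  length-layer : ∀ i → length (layer A n i) ≡ sum (map (λ α → choicesOver (max 0 α) (A i)) (A (n ∸ i)))
  length-layer i = trans (length-concatMap _ (A (n ∸ i))) (cong sum (map-cong per-left (A (n ∸ i))))
    where
    per-left : ∀ α → length (concatMap (choicesFor α) (A i)) ≡ choicesOver (max 0 α) (A i)
    per-left α = trans (length-concatMap (choicesFor α) (A i)) (cong sum (map-cong (length-choicesFor α) (A i)))

  length-layer-<n : ∀ {i} → i < n → length (layer A n i) ≡ a (n ∸ i) * choicesOver 1 (A i)
  length-layer-<n {i} i<n = begin
    length (layer A n i)                                 ≡⟨ length-layer i ⟩
    sum (map (λ α → choicesOver (max 0 α) (A i)) (A (n ∸ i))) ≡⟨ sum-map-cong-∈ (A (n ∸ i)) left-irrelevant ⟩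
    sum (map (λ _ → choicesOver 1 (A i)) (A (n ∸ i)))    ≡⟨ sum-map-const (A (n ∸ i)) _ ⟩
    length (A (n ∸ i)) * choicesOver 1 (A i)             ≡⟨ cong (_* _) (Enumerates⇒length≡a (IHˡ i)) ⟩
    a (n ∸ i) * choicesOver 1 (A i)                      ∎
    where
    open ≡-Reasoning
    left-irrelevant : ∀ {α} → α ∈ A (n ∸ i) → choicesOver (max 0 α) (A i) ≡ choicesOver 1 (A i)
    left-irrelevant α∈ =
      cong sum (map-cong (λ β → choices-positive (max 0 β) (max-positive (IHˡ i) (m<n⇒0<n∸m i<n) α∈)) (A i))

  length-layer-0 : 1 ≤ n → length (layer A n 0) ≡ a n
  length-layer-0 1≤n = begin
    length (layer A n 0)     ≡⟨ length-layer-<n 1≤n ⟩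
    a n * choicesOver 1 (A 0) ≡⟨ cong (a n *_) (choicesOver-empty (IH 0 z≤n) 1 refl) ⟩
    a n * (length (A 0) * 1) ≡⟨ cong (λ l → a n * (l * 1)) (Enumerates⇒length≡a (IH 0 z≤n)) ⟩
    a n * 1                  ≡⟨ *-identityʳ (a n) ⟩
    a n                      ∎
    where open ≡-Reasoning

  length-layer-mid : ∀ {i} → 1 ≤ i → i < n → length (layer A n i) ≡ a (n ∸ i) * (4 * a i ∸ 1)
  length-layer-mid {i} 1≤i i<n = trans (length-layer-<n i<n) (cong (a (n ∸ i) *_) (begin
    choicesOver 1 (A i)         ≡⟨ m+n∸n≡m (choicesOver 1 (A i)) 1 ⟨
    choicesOver 1 (A i) + 1 ∸ 1 ≡⟨ cong (_∸ 1) (choicesOver-1 (IH i (<⇒≤ i<n)) 1≤i) ⟩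
    4 * length (A i) ∸ 1        ≡⟨ cong (λ l → 4 * l ∸ 1) (Enumerates⇒length≡a (IH i (<⇒≤ i<n))) ⟩
    4 * a i ∸ 1                 ∎))
    where open ≡-Reasoning

  length-layer-n : 1 ≤ n → length (layer A n n) ≡ a n * 2
  length-layer-n 1≤n = begin
    length (layer A n n)                                       ≡⟨ length-layer n ⟩
    sum (map (λ α → choicesOver (max 0 α) (A n)) (A (n ∸ n)))  ≡⟨ sum-map-cong-∈ (A (n ∸ n)) left-empty ⟩
    sum (map (λ _ → choicesOver 0 (A n)) (A (n ∸ n)))          ≡⟨ sum-map-const (A (n ∸ n)) _ ⟩
    length (A (n ∸ n)) * choicesOver 0 (A n)                   ≡⟨ cong₂ _*_ |A₀| (choicesOver-0 (IH n ≤-refl) 1≤n) ⟩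
    a 0 * (length (A n) * 2)                                   ≡⟨ cong (λ l → l * 2 + 0) (Enumerates⇒length≡a (IH n ≤-refl)) ⟩
    a n * 2 + 0                                                ≡⟨ +-identityʳ (a n * 2) ⟩
    a n * 2                                                    ∎
    where
    open ≡-Reasoning
    left-empty : ∀ {α} → α ∈ A (n ∸ n) → choicesOver (max 0 α) (A n) ≡ choicesOver 0 (A n)
    left-empty {α} α∈ = cong (λ α → choicesOver (max 0 α) (A n))
      (length≡0⇒[] {xs = α} (trans (proj₁ (Enumerates.sound (IHˡ n) α∈)) (n∸n≡0 n)))
    |A₀| : length (A (n ∸ n)) ≡ a 0
    |A₀| = trans (Enumerates⇒length≡a (IHˡ n)) (cong a (n∸n≡0 n))

-- The recurrence

open import Data.Integer using (ℤ; +_)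

pos-sum : ∀ {A : Set} (xs : List A) (f : A → ℕ) (g : A → ℤ) → (∀ {x} → x ∈ xs → + f x ≡ g x) →
          + sum (map f xs) ≡ foldr ℤ._+_ (+ 0) (map g xs)
pos-sum []       f g _   = refl
pos-sum (x ∷ xs) f g f≡g =
  trans (ℤ.pos-+ (f x) _) (cong₂ ℤ._+_ (f≡g (here refl)) (pos-sum xs f g (f≡g ∘ there)))

a-positive : ∀ i → 1 ≤ a i
a-positive i = subst (1 ≤_) (Enumerates⇒length≡a e) (nonempty (replicate∈ e))
  where
  e = avoiders-enumerate {i} ≤-refl
  nonempty : ∀ {w ws} → w ∈ ws → 1 ≤ length ws
  nonempty {ws = _ ∷ _} _ = s≤s z≤n

a-recurrenceℕ : ∀ m →
  a (2 + m) ≡ 3 * a (suc m) + sum (map (λ i → a (suc m ∸ i) * (4 * a i ∸ 1)) (applyUpTo suc m))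
a-recurrenceℕ m = begin
  a (suc n)                               ≡⟨ Enumerates⇒length≡a (avoiders-enumerate {suc n} ≤-refl) ⟨
  length (map glue (candidates A n))      ≡⟨ length-map glue (candidates A n) ⟩
  length (candidates A n)                 ≡⟨ length-concatMap (layer A n) (upTo (suc n)) ⟩
  sum (map L (upTo (suc n)))              ≡⟨ sum-upTo-suc L n ⟩
  L 0 + sum (map L (applyUpTo suc m)) + L n
    ≡⟨ cong₂ _+_ (cong₂ _+_ (length-layer-0 1≤n) (sum-map-cong-∈ (applyUpTo suc m) middle)) (length-layer-n 1≤n) ⟩
  a n + S + a n * 2                       ≡⟨ arithmetic (a n) S ⟩
  3 * a n + S                             ∎
  where
  open ≡-Reasoning
  n = suc m
  1≤n = s≤s z≤n
  A = avoiders n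
  open Layers A n (λ i i≤n → avoiders-enumerate i≤n)
  L = length ∘ layer A n
  S = sum (map (λ i → a (n ∸ i) * (4 * a i ∸ 1)) (applyUpTo suc m))
  middle : ∀ {i} → i ∈ applyUpTo suc m → L i ≡ a (n ∸ i) * (4 * a i ∸ 1)
  middle i∈ with j , j<m , refl ← ∈-applyUpTo⁻ suc i∈ = length-layer-mid (s≤s z≤n) (s≤s j<m)
  arithmetic : ∀ x y → x + y + x * 2 ≡ 3 * x + y
  arithmetic = solve-∀

pos-4*-1 : ∀ x → 1 ≤ x → + (4 * x ∸ 1) ≡ + 4 ℤ.* + x ℤ.- + 1
pos-4*-1 (suc x) _ = refl

a-recurrence : (n : ℕ) → 1 ≤ n →
  + a (suc n) ≡ foldr ℤ._+_ (+ 0) (map (λ i → (+ 4 ℤ.* + a i ℤ.- + 1) ℤ.* + a (n ∸ i)) (upTo n))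
a-recurrence (suc m) _ = begin
  + a (2 + m)                 ≡⟨ cong +_ (a-recurrenceℕ m) ⟩
  + (3 * a (suc m) + S)       ≡⟨ ℤ.pos-+ (3 * a (suc m)) S ⟩
  + (3 * a (suc m)) ℤ.+ + S   ≡⟨ cong₂ ℤ._+_ (ℤ.pos-* 3 (a (suc m))) (pos-sum (applyUpTo suc m) _ _ term) ⟩
  foldr ℤ._+_ (+ 0) (map (λ i → (+ 4 ℤ.* + a i ℤ.- + 1) ℤ.* + a (suc m ∸ i)) (upTo (suc m))) ∎
  where
  -- The term i = 0 is (4 a 0 - 1) a (suc m), which evaluates to 3 a (suc m).
  open ≡-Reasoning
  S = sum (map (λ i → a (suc m ∸ i) * (4 * a i ∸ 1)) (applyUpTo suc m))
  term : ∀ {i} → i ∈ applyUpTo suc m →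
         + (a (suc m ∸ i) * (4 * a i ∸ 1)) ≡ (+ 4 ℤ.* + a i ℤ.- + 1) ℤ.* + a (suc m ∸ i)
  term {i} _ = trans (ℤ.pos-* (a (suc m ∸ i)) _)
                 (trans (ℤ.*-comm (+ a (suc m ∸ i)) _) (cong (ℤ._* + a (suc m ∸ i)) (pos-4*-1 (a i) (a-positive i))))

proposition6p10 : (a 0 ≡ 1) × (a 1 ≡ 1)
    × ((n : ℕ) → 1 ≤ n →
    + a (suc n) ≡ foldr ℤ._+_ (+ 0) (map (λ i → (+ 4 ℤ.* + a i ℤ.- + 1) ℤ.* + a (n ∸ i)) (upTo n)))
proposition6p10 = refl , refl , a-recurrence
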